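{- Let $p = p_1p_2\ldots p_m$ and $w = w_1w_2\ldots w_n$ be binary words (letters in $\{0,1\}$). Write $p = A_1A_2\ldots A_r$ as the concatenation of its $r$ runs and $w = B_1B_2\ldots B_s$ as the concatenation of its $s$ runs. Suppose the lexicographically minimal occurrence $\mathrm{L}_p(w)$ of $p$ in $w$ exists. Then its heads $\mathrm{L}_p^i(w)$ satisfy: (1) $\mathrm{L}_p^1(w) = \alpha_p^w$; (2) for each $i \in \{1,\ldots,r-1\}$, $\mathrm{L}_p^{i+1}(w) = \mathrm{L}_p^i(w) + 2\rho(w;\mathrm{L}_p^i(w);|A_i|) + 1$.
   Context: A run of a binary word is a maximal block of consecutive identical letters; a run is even if it consists of 0's and odd if it consists of 1's (its parity). A subword of $w$ is obtained by deleting letters and is identified with its tuple of indices in $w$; an occurrence of $p$ in $w$ is a subword of $w$ equal to $p$. For runs $B_i, B_j$ of $w$ of the same parity with $i \le j$, $\sigma(w;i,j) := \sum_{k=0}^{(j-i)/2}|B_{i+2k}|$. The same-parity right-span is $\rho(w;i;j) := \min\{k \mid \sigma(w;i,i+2k) \ge j\}$. Define $\alpha_p^w := 1$ if $A_1$ and $B_1$ have the same parity and $\alpha_p^w := 2$ otherwise. The lexicographically minimal occurrence $\mathrm{L}_p(w)$ is an occurrence of $p$ in $w$ such that for every occurrence $p'$ of $p$ in $w$ and every $j \in [m]$, the $j$th letter of $p'$ is not to the left (in $w$) of the $j$th letter of $\mathrm{L}_p(w)$. Write $\mathrm{L}_p(w) = L_1L_2\ldots L_r$ where $L_i$ is the part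 of $\mathrm{L}_p(w)$ corresponding to $A_i$. For a letter $w_k$, let $\mathrm{R}(w,w_k)\in[s]$ be the index of the run of $w$ containing $w_k$. The $i$th head is $\mathrm{L}_p^i(w) := \mathrm{R}(w,w_{l})$, where $w_l$ is the first letter of $L_i$. -}

module Defs where

open import Data.Bool using (Bool; true; false; if_then_else_)
open import Data.Bool.Properties using () renaming (_≟_ to _≟ᵇ_)
open import Data.Nat using (ℕ; zero; suc; _+_; _*_; _∸_; _≤_; _<_)
open import Data.Nat.Properties using (_<?_)
open import Data.Nat.DivMod using (_/_)
open import Data.List using (List; []; _∷_; length; lookup)
open import Data.Fin using (Fin; toℕ; fromℕ<)
open import Data.Product using (_×_; _,_)
open import Relation.Nullary using (yes; no; does)
open import Relation.Binary.PropositionalEquality using (_≡_)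

-- A binary word is a list of Booleans (false = 0, true = 1).
Word : Set
Word = List Bool

-- Run decomposition: list of (letter, length) of the maximal blocks, in order.
runs : Word → List (Bool × ℕ)
runs [] = []
runs (b ∷ xs) with runs xs
... | [] = (b , 1) ∷ []
... | (c , k) ∷ rs = if does (b ≟ᵇ c) then (c , suc k) ∷ rs else (b , 1) ∷ (c , k) ∷ rs

numRuns : Word → ℕ
numRuns w = length (runs w)

private
  lenAt : List (Bool × ℕ) → ℕ → ℕ
  lenAt [] _ = 0
  lenAt ((_ , l) ∷ rs) zero = l
  lenAt (_ ∷ rs) (suc i) = lenAt rs i

  startAt : List (Bool × ℕ) → ℕ → ℕ
  startAt [] _ = 0
  startAt _ zero = 0
  startAt ((_ , l) ∷ rs) (suc i) = l + startAt rs i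

  idxAt : List (Bool × ℕ) → ℕ → ℕ
  idxAt [] _ = 0
  idxAt ((_ , l) ∷ rs) k with k <? l
  ... | yes _ = 1
  ... | no _ = suc (idxAt rs (k ∸ l))

-- |B_i| : length of the i-th run (runs are 1-indexed; 0 if out of range)
runLen : Word → ℕ → ℕ
runLen w zero = 0
runLen w (suc i) = lenAt (runs w) i

-- 0-based position of the first letter of the i-th run (1-indexed)
runStart : Word → ℕ → ℕ
runStart w zero = 0
runStart w (suc i) = startAt (runs w) i

-- R(w, w_k): 1-based index of the run containing the letter at 0-based position k
runIndex : Word → ℕ → ℕ
runIndex w k = idxAt (runs w) k

sumUpTo : (ℕ → ℕ) → ℕ → ℕ
sumUpTo f zero = f 0
sumUpTo f (suc K) = sumUpTo f K + f (suc K)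

σ : Word → ℕ → ℕ → ℕ
σ w i j = sumUpTo (λ k → runLen w (i + 2 * k)) ((j ∸ i) / 2)

IsRho : Word → ℕ → ℕ → ℕ → Set
IsRho w i j k =
  (i + 2 * k ≤ numRuns w) × (j ≤ σ w i (i + 2 * k)) ×
  (∀ k' → k' < k → σ w i (i + 2 * k') < j)

α : Word → Word → ℕ
α (a ∷ _) (b ∷ _) = if does (a ≟ᵇ b) then 1 else 2
α _ _ = 1

record Occurrence (p w : Word) : Set where
  field
    pos      : Fin (length p) → Fin (length w)
    increasing : ∀ j j' → toℕ j < toℕ j' → toℕ (pos j) < toℕ (pos j')
    matches  : ∀ j → lookup w (pos j) ≡ lookup p j
open Occurrence public

IsLexMinOcc : (p w : Word) → Occurrence p w → Set
IsLexMinOcc p w L = ∀ (O : Occurrence p w) (j : Fin (length p)) →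
  toℕ (pos L j) ≤ toℕ (pos O j)

head : (p w : Word) → Occurrence p w → ℕ → ℕ
head p w L i with runStart p i <? length p
... | yes lt = runIndex w (toℕ (pos L (fromℕ< lt)))
... | no _ = 0

-- The lexicographically minimal occurrence is greedy: each letter of p sits at the first position
-- of w after the previous letter's position that carries the right letter, since an earlier
-- admissible position could replace it and give a smaller occurrence. Hence the letters of a run
-- A_i of p, all of one parity, fill B_h, B_{h+2}, B_{h+4}, ... from their first letters on, and the
-- first letter of A_{i+1}, of the other parity, lands on the first letter of the run following the
-- last one used, B_{h+2k+1} with k = rho(w;h;|A_i|). Likewise the first letter of p lands on B_1 or
-- B_2 according to its parity.

module Submission where

open import Defs
open import Data.Bool using (Bool; false; not; if_then_else_)
open import Data.Bool.Properties using (¬-not; not-¬; not-involutive) renaming (_≟_ to _≟ᵇ_)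
open import Data.Fin using (Fin; toℕ; fromℕ<) renaming (_≟_ to _≟ᶠ_)
open import Data.Fin.Properties using (toℕ<n; toℕ-fromℕ<; fromℕ<-toℕ)
open import Data.List using ([]; _∷_; length; lookup)
open import Data.Nat
open import Data.Nat.DivMod using (_/_; m*n/n≡m)
open import Data.Nat.Properties
open import Data.Product using (_×_; _,_; ∃; ∃₂; proj₁; proj₂)
open import Data.Sum using (inj₁; inj₂)
open import Data.Unit using (⊤)
open import Function using (_∘_)
open import Relation.Nullary using (Dec; yes; no; does; contradiction)
open import Relation.Binary.PropositionalEquality

-- Junk value false past the end of the word.
at : Word → ℕ → Bool
at [] _ = false
at (b ∷ _) zero = b
at (_ ∷ xs) (suc k) = at xs k

data NewRun (b : Bool) : Word → Set where
  [] : NewRun b []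
  _∷_ : ∀ {c} → b ≢ c → ∀ ys → NewRun b (c ∷ ys)

runs-cons : ∀ b xs → ∃₂ λ k rs → runs (b ∷ xs) ≡ (b , suc k) ∷ rs
runs-cons b xs with runs xs
... | [] = 0 , [] , refl
... | (c , k) ∷ rs with b ≟ᵇ c
...   | yes refl = k , rs , refl
...   | no _ = 0 , (c , k) ∷ rs , refl

runs-new : ∀ {b xs} → NewRun b xs → runs (b ∷ xs) ≡ (b , 1) ∷ runs xs
runs-new [] = refl
runs-new {b} (_∷_ {c} b≢c ys) with runs-cons c ys
... | k , rs , eq rewrite eq with b ≟ᵇ c
...   | yes b≡c = contradiction b≡c b≢c
...   | no _ = refl

runs-extend : ∀ b ys → ∃₂ λ k rs →
  runs (b ∷ ys) ≡ (b , k) ∷ rs × runs (b ∷ b ∷ ys) ≡ (b , suc k) ∷ rs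
runs-extend b ys with runs-cons b ys
... | k , rs , eq rewrite eq with b ≟ᵇ b
...   | yes _ = suc k , rs , refl , refl
...   | no b≢b = contradiction refl b≢b

run-ind : (P : Word → Set) → P [] →
  (∀ {b xs} → NewRun b xs → P xs → P (b ∷ xs)) →
  (∀ b ys → P (b ∷ ys) → P (b ∷ b ∷ ys)) →
  ∀ u → P u
run-ind P nil new extend [] = nil
run-ind P nil new extend (b ∷ []) = new [] nil
run-ind P nil new extend (b ∷ c ∷ ys) = step (b ≟ᵇ c) (run-ind P nil new extend (c ∷ ys))
  where
  step : Dec (b ≡ c) → P (c ∷ ys) → P (b ∷ c ∷ ys)
  step (yes refl) = extend b ys
  step (no b≢c) = new (b≢c ∷ ys)

runStart₁ : ∀ u → runStart u 1 ≡ 0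
runStart₁ u with runs u
... | [] = refl
... | _ ∷ _ = refl

runIndex₀ : ∀ b xs → runIndex (b ∷ xs) 0 ≡ 1
runIndex₀ b xs with runs-cons b xs
... | _ , _ , eq rewrite eq = refl

runStart₁≤ : ∀ u x → runStart u 1 ≤ x
runStart₁≤ u x = ≤-trans (≤-reflexive (runStart₁ u)) z≤n

numRuns-cons : ∀ b xs → 1 ≤ numRuns (b ∷ xs)
numRuns-cons b xs with runs-cons b xs
... | _ , _ , eq rewrite eq = s≤s z≤n

module _ {b xs} (new : NewRun b xs) where

  numRuns-new : numRuns (b ∷ xs) ≡ suc (numRuns xs)
  numRuns-new rewrite runs-new new = refl

  runLen-new₁ : runLen (b ∷ xs) 1 ≡ 1
  runLen-new₁ rewrite runs-new new = refl

  runLen-new : ∀ i → runLen (b ∷ xs) (suc (suc i)) ≡ runLen xs (suc i)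
  runLen-new i rewrite runs-new new = refl

  runStart-new : ∀ i → runStart (b ∷ xs) (suc (suc i)) ≡ suc (runStart xs (suc i))
  runStart-new i rewrite runs-new new = refl

  runIndex-new : ∀ x → runIndex (b ∷ xs) (suc x) ≡ suc (runIndex xs x)
  runIndex-new x rewrite runs-new new = refl

  run≤-new : ∀ {i} → suc (suc i) ≤ numRuns (b ∷ xs) → suc i ≤ numRuns xs
  run≤-new i≤ = s≤s⁻¹ (subst (_ ≤_) numRuns-new i≤)

module _ (b : Bool) (ys : Word) where

  numRuns-extend : numRuns (b ∷ b ∷ ys) ≡ numRuns (b ∷ ys)
  numRuns-extend with runs-extend b ys
  ... | _ , _ , eq , eq′ rewrite eq | eq′ = refl

  runLen-extend₁ : runLen (b ∷ b ∷ ys) 1 ≡ suc (runLen (b ∷ ys) 1)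
  runLen-extend₁ with runs-extend b ys
  ... | _ , _ , eq , eq′ rewrite eq | eq′ = refl

  runLen-extend : ∀ i → runLen (b ∷ b ∷ ys) (suc (suc i)) ≡ runLen (b ∷ ys) (suc (suc i))
  runLen-extend i with runs-extend b ys
  ... | _ , _ , eq , eq′ rewrite eq | eq′ = refl

  runStart-extend : ∀ i → runStart (b ∷ b ∷ ys) (suc (suc i)) ≡ suc (runStart (b ∷ ys) (suc (suc i)))
  runStart-extend i with runs-extend b ys
  ... | _ , _ , eq , eq′ rewrite eq | eq′ = refl

  run≤-extend : ∀ {t} → t ≤ numRuns (b ∷ b ∷ ys) → t ≤ numRuns (b ∷ ys)
  run≤-extend = subst (_ ≤_) numRuns-extend

  runIndex-extend : ∀ x → runIndex (b ∷ b ∷ ys) (suc x) ≡ runIndex (b ∷ ys) x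
  runIndex-extend x with runs-extend b ys
  ... | k , _ , eq , eq′ rewrite eq | eq′ with suc x <? suc k | x <? k
  ...   | yes _ | yes _ = refl
  ...   | no _ | no _ = refl
  ...   | yes x<k | no x≮k = contradiction (s≤s⁻¹ x<k) x≮k
  ...   | no x≮k | yes x<k = contradiction (s≤s x<k) x≮k

runLen-positive : ∀ u {t} → 1 ≤ t → t ≤ numRuns u → 1 ≤ runLen u t
runLen-positive = run-ind P (λ { {suc _} _ () }) new extend
  where
  P : Word → Set
  P u = ∀ {t} → 1 ≤ t → t ≤ numRuns u → 1 ≤ runLen u t
  new : ∀ {b xs} → NewRun b xs → P xs → P (b ∷ xs)
  new s ih {1} _ _ rewrite runLen-new₁ s = ≤-refl
  new s ih {suc (suc i)} _ t≤ rewrite runLen-new s i =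
    ih (s≤s z≤n) (run≤-new s t≤)
  extend : ∀ b ys → P (b ∷ ys) → P (b ∷ b ∷ ys)
  extend b ys ih {1} _ _ rewrite runLen-extend₁ b ys = s≤s z≤n
  extend b ys ih {suc (suc i)} t≥1 t≤ rewrite runLen-extend b ys i =
    ih t≥1 (run≤-extend b ys t≤)

runEnd≤length : ∀ u {t} → 1 ≤ t → t ≤ numRuns u → runStart u t + runLen u t ≤ length u
runEnd≤length = run-ind P (λ { {suc _} _ () }) new extend
  where
  P : Word → Set
  P u = ∀ {t} → 1 ≤ t → t ≤ numRuns u → runStart u t + runLen u t ≤ length u
  new : ∀ {b xs} → NewRun b xs → P xs → P (b ∷ xs)
  new {b} {xs} s ih {1} _ _ rewrite runStart₁ (b ∷ xs) | runLen-new₁ s = s≤s z≤n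
  new s ih {suc (suc i)} _ t≤ rewrite runStart-new s i | runLen-new s i =
    s≤s (ih (s≤s z≤n) (run≤-new s t≤))
  extend : ∀ b ys → P (b ∷ ys) → P (b ∷ b ∷ ys)
  extend b ys ih {1} t≥1 _ rewrite runStart₁ (b ∷ b ∷ ys) | runLen-extend₁ b ys =
    s≤s (≤-trans (m≤n+m _ _) (ih t≥1 (numRuns-cons b ys)))
  extend b ys ih {suc (suc i)} t≥1 t≤ rewrite runStart-extend b ys i | runLen-extend b ys i =
    s≤s (ih t≥1 (run≤-extend b ys t≤))

runIndex-runStart : ∀ u {t} → 1 ≤ t → t ≤ numRuns u → runIndex u (runStart u t) ≡ t
runIndex-runStart = run-ind P (λ { {suc _} _ () }) new extend
  where
  P : Word → Set
  P u = ∀ {t} → 1 ≤ t → t ≤ numRuns u → runIndex u (runStart u t) ≡ t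
  new : ∀ {b xs} → NewRun b xs → P xs → P (b ∷ xs)
  new {b} {xs} s ih {1} _ _ rewrite runStart₁ (b ∷ xs) = runIndex₀ b xs
  new {b} {xs} s ih {suc (suc i)} _ t≤
    rewrite runStart-new s i | runIndex-new s (runStart xs (suc i)) =
    cong suc (ih (s≤s z≤n) (run≤-new s t≤))
  extend : ∀ b ys → P (b ∷ ys) → P (b ∷ b ∷ ys)
  extend b ys ih {1} _ _ rewrite runStart₁ (b ∷ b ∷ ys) = runIndex₀ b (b ∷ ys)
  extend b ys ih {suc (suc i)} t≥1 t≤
    rewrite runStart-extend b ys i | runIndex-extend b ys (runStart (b ∷ ys) (suc (suc i))) =
    ih t≥1 (run≤-extend b ys t≤)

at-inRun : ∀ u {t x} → 1 ≤ t → t ≤ numRuns u → runStart u t ≤ x → x < runStart u t + runLen u t →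
  at u x ≡ at u (runStart u t)
at-inRun = run-ind P (λ { {suc _} _ () }) new extend
  where
  P : Word → Set
  P u = ∀ {t x} → 1 ≤ t → t ≤ numRuns u → runStart u t ≤ x → x < runStart u t + runLen u t →
    at u x ≡ at u (runStart u t)
  new : ∀ {b xs} → NewRun b xs → P xs → P (b ∷ xs)
  new {b} {xs} s ih {1} {zero} _ _ _ _ rewrite runStart₁ (b ∷ xs) = refl
  new {b} {xs} s ih {1} {suc x} _ _ _ x< rewrite runStart₁ (b ∷ xs) | runLen-new₁ s with x<
  ... | s≤s ()
  new s ih {suc (suc i)} {zero} _ _ ≤x _ rewrite runStart-new s i with ≤x
  ... | ()
  new s ih {suc (suc i)} {suc x} _ t≤ ≤x x< rewrite runStart-new s i | runLen-new s i =
    ih (s≤s z≤n) (run≤-new s t≤) (s≤s⁻¹ ≤x) (s≤s⁻¹ x<)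
  extend : ∀ b ys → P (b ∷ ys) → P (b ∷ b ∷ ys)
  extend b ys ih {1} {zero} _ _ _ _ rewrite runStart₁ (b ∷ b ∷ ys) = refl
  extend b ys ih {1} {suc x} t≥1 _ _ x< rewrite runStart₁ (b ∷ b ∷ ys) | runLen-extend₁ b ys =
    trans (ih t≥1 (numRuns-cons b ys) (runStart₁≤ (b ∷ ys) x)
                  (subst (λ z → x < z + runLen (b ∷ ys) 1) (sym (runStart₁ (b ∷ ys))) (s≤s⁻¹ x<)))
          (cong (at (b ∷ ys)) (runStart₁ (b ∷ ys)))
  extend b ys ih {suc (suc i)} {zero} _ _ ≤x _ rewrite runStart-extend b ys i with ≤x
  ... | ()
  extend b ys ih {suc (suc i)} {suc x} t≥1 t≤ ≤x x< rewrite runStart-extend b ys i | runLen-extend b ys i =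
    ih t≥1 (run≤-extend b ys t≤) (s≤s⁻¹ ≤x) (s≤s⁻¹ x<)

nextRun : ∀ u {t} → 1 ≤ t → suc t ≤ numRuns u →
  runStart u (suc t) ≡ runStart u t + runLen u t × at u (runStart u (suc t)) ≡ not (at u (runStart u t))
nextRun = run-ind P (λ { _ () }) new extend
  where
  P : Word → Set
  P u = ∀ {t} → 1 ≤ t → suc t ≤ numRuns u →
    runStart u (suc t) ≡ runStart u t + runLen u t × at u (runStart u (suc t)) ≡ not (at u (runStart u t))
  new : ∀ {b xs} → NewRun b xs → P xs → P (b ∷ xs)
  new [] ih {1} _ (s≤s ())
  new {b} s@(_∷_ {c} b≢c ys) ih {1} _ _
    rewrite runStart-new s 0 | runStart₁ (c ∷ ys) | runStart₁ (b ∷ c ∷ ys) | runLen-new₁ s =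
    refl , ¬-not (≢-sym b≢c)
  new s ih {suc (suc i)} _ t≤ rewrite runStart-new s (suc i) | runStart-new s i | runLen-new s i
    with ih (s≤s z≤n) (run≤-new s t≤)
  ... | start≡ , letter≡ = cong suc start≡ , letter≡
  extend : ∀ b ys → P (b ∷ ys) → P (b ∷ b ∷ ys)
  extend b ys ih {1} t≥1 t≤
    rewrite runStart-extend b ys 0 | runStart₁ (b ∷ b ∷ ys) | runLen-extend₁ b ys
    with ih t≥1 (run≤-extend b ys t≤)
  ... | start≡ , letter≡ rewrite runStart₁ (b ∷ ys) = cong suc start≡ , letter≡
  extend b ys ih {suc (suc i)} t≥1 t≤
    rewrite runStart-extend b ys (suc i) | runStart-extend b ys i | runLen-extend b ys i
    with ih t≥1 (run≤-extend b ys t≤)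
  ... | start≡ , letter≡ = cong suc start≡ , letter≡

nextRun-exists : ∀ u {t} → 1 ≤ t → t ≤ numRuns u → runStart u t + runLen u t < length u →
  suc t ≤ numRuns u
nextRun-exists = run-ind P (λ { _ _ () }) new extend
  where
  P : Word → Set
  P u = ∀ {t} → 1 ≤ t → t ≤ numRuns u → runStart u t + runLen u t < length u → suc t ≤ numRuns u
  new : ∀ {b xs} → NewRun b xs → P xs → P (b ∷ xs)
  new {b} [] ih {1} _ _ end< rewrite runStart₁ (b ∷ []) with end<
  ... | s≤s ()
  new s@(_∷_ {c} _ ys) ih {1} _ _ _ rewrite numRuns-new s = s≤s (numRuns-cons c ys)
  new s ih {suc (suc i)} _ t≤ end< rewrite runStart-new s i | runLen-new s i | numRuns-new s =
    s≤s (ih (s≤s z≤n) (s≤s⁻¹ t≤) (s≤s⁻¹ end<))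
  extend : ∀ b ys → P (b ∷ ys) → P (b ∷ b ∷ ys)
  extend b ys ih {1} t≥1 t≤ end<
    rewrite runStart₁ (b ∷ b ∷ ys) | runLen-extend₁ b ys | numRuns-extend b ys =
    ih t≥1 t≤ (subst (λ z → z + runLen (b ∷ ys) 1 < length (b ∷ ys)) (sym (runStart₁ (b ∷ ys)))
                     (s≤s⁻¹ end<))
  extend b ys ih {suc (suc i)} t≥1 t≤ end<
    rewrite runStart-extend b ys i | runLen-extend b ys i | numRuns-extend b ys =
    ih t≥1 t≤ (s≤s⁻¹ end<)

leaveRun : ∀ u {t y} → 1 ≤ t → t ≤ numRuns u → runStart u t ≤ y → y < length u →
  at u y ≢ at u (runStart u t) → suc t ≤ numRuns u × runStart u (suc t) ≤ y
leaveRun u {t} {y} t≥1 t≤ start≤y y<n y≢ =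
  next , subst (_≤ y) (sym (proj₁ (nextRun u t≥1 next))) end≤y
  where
  end≤y : runStart u t + runLen u t ≤ y
  end≤y = ≮⇒≥ λ y<end → y≢ (at-inRun u t≥1 t≤ start≤y y<end)
  next : suc t ≤ numRuns u
  next = nextRun-exists u t≥1 t≤ (≤-<-trans end≤y y<n)

skipRun : ∀ u {t y} → 1 ≤ t → t ≤ numRuns u → runStart u t + runLen u t ≤ y → y < length u →
  at u y ≡ at u (runStart u t) →
  suc (suc t) ≤ numRuns u × runStart u t + runLen u t ≤ runStart u (suc (suc t)) ×
  runStart u (suc (suc t)) ≤ y × at u (runStart u (suc (suc t))) ≡ at u (runStart u t)
skipRun u {t} {y} t≥1 t≤ end≤y y<n y-letter =
  next₂ , end≤start₂ , proj₂ leave₁ , letter₂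
  where
  next₁ : suc t ≤ numRuns u
  next₁ = nextRun-exists u t≥1 t≤ (≤-<-trans end≤y y<n)
  start₁≡ : runStart u (suc t) ≡ runStart u t + runLen u t
  start₁≡ = proj₁ (nextRun u t≥1 next₁)
  letter₁ : at u (runStart u (suc t)) ≡ not (at u (runStart u t))
  letter₁ = proj₂ (nextRun u t≥1 next₁)
  y≢letter₁ : at u y ≢ at u (runStart u (suc t))
  y≢letter₁ y≡ = not-¬ refl (trans (sym y-letter) (trans y≡ letter₁))
  leave₁ : suc (suc t) ≤ numRuns u × runStart u (suc (suc t)) ≤ y
  leave₁ = leaveRun u (s≤s z≤n) next₁ (subst (_≤ y) (sym start₁≡) end≤y) y<n y≢letter₁
  next₂ : suc (suc t) ≤ numRuns u
  next₂ = proj₁ leave₁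
  end≤start₂ : runStart u t + runLen u t ≤ runStart u (suc (suc t))
  end≤start₂ = begin
    runStart u t + runLen u t                            ≡⟨ start₁≡ ⟨
    runStart u (suc t)                                   ≤⟨ m≤m+n _ _ ⟩
    runStart u (suc t) + runLen u (suc t)                ≡⟨ proj₁ (nextRun u (s≤s z≤n) next₂) ⟨
    runStart u (suc (suc t))                             ∎
    where open ≤-Reasoning
  letter₂ : at u (runStart u (suc (suc t))) ≡ at u (runStart u t)
  letter₂ = trans (proj₂ (nextRun u (s≤s z≤n) next₂)) (trans (cong not letter₁) (not-involutive _))

runStart<length : ∀ u {t} → 1 ≤ t → t ≤ numRuns u → runStart u t < length u
runStart<length u t≥1 t≤ = <-≤-trans (m<m+n _ (runLen-positive u t≥1 t≤)) (runEnd≤length u t≥1 t≤)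

numRuns-positive : ∀ u → 0 < length u → 1 ≤ numRuns u
numRuns-positive (b ∷ xs) _ = numRuns-cons b xs

length-positive : ∀ u → 1 ≤ numRuns u → 0 < length u
length-positive (_ ∷ _) _ = s≤s z≤n

lookup≡at : ∀ (u : Word) i → lookup u i ≡ at u (toℕ i)
lookup≡at (b ∷ u) Fin.zero = refl
lookup≡at (b ∷ u) (Fin.suc i) = lookup≡at u i

module _ {p w : Word} (L : Occurrence p w) (j : Fin (length p)) (q : Fin (length w)) where

  movePos : Fin (length p) → Fin (length w)
  movePos f with f ≟ᶠ j
  ... | yes _ = q
  ... | no _ = pos L f

  movePos-self : movePos j ≡ q
  movePos-self with j ≟ᶠ j
  ... | yes _ = refl
  ... | no j≢j = contradiction refl j≢j

  move : lookup w q ≡ lookup p j →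
    (∀ f → toℕ f < toℕ j → toℕ (pos L f) < toℕ q) →
    (∀ f → toℕ j < toℕ f → toℕ q < toℕ (pos L f)) →
    Occurrence p w
  move q-matches below above = record { pos = movePos ; increasing = inc ; matches = mat }
    where
    inc : ∀ f g → toℕ f < toℕ g → toℕ (movePos f) < toℕ (movePos g)
    inc f g f<g with f ≟ᶠ j | g ≟ᶠ j
    ... | yes refl | yes refl = contradiction f<g (<-irrefl refl)
    ... | yes refl | no _ = above g f<g
    ... | no _ | yes refl = below f f<g
    ... | no _ | no _ = increasing L f g f<g
    mat : ∀ f → lookup w (movePos f) ≡ lookup p f
    mat f with f ≟ᶠ j
    ... | yes refl = q-matches
    ... | no _ = matches L f

lexMin-least : ∀ {p w} (L : Occurrence p w) → IsLexMinOcc p w L →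
  ∀ j q → lookup w q ≡ lookup p j → (∀ f → toℕ f < toℕ j → toℕ (pos L f) < toℕ q) →
  toℕ (pos L j) ≤ toℕ q
lexMin-least L minimal j q q-matches below = ≮⇒≥ λ q<j →
  let O = move L j q q-matches below (λ g j<g → <-trans q<j (increasing L j g j<g))
  in <⇒≱ q<j (subst (λ r → toℕ (pos L j) ≤ toℕ r) (movePos-self L j q) (minimal O j))

sumBelow : (ℕ → ℕ) → ℕ → ℕ
sumBelow f zero = 0
sumBelow f (suc k) = sumBelow f k + f k

sumUpTo≡sumBelow : ∀ f k → sumUpTo f k ≡ sumBelow f (suc k)
sumUpTo≡sumBelow f zero = refl
sumUpTo≡sumBelow f (suc k) = cong (_+ f (suc k)) (sumUpTo≡sumBelow f k)

sumBelow-mono : ∀ f {k k′} → k ≤ k′ → sumBelow f k ≤ sumBelow f k′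
sumBelow-mono f {k′ = zero} z≤n = ≤-refl
sumBelow-mono f {k′ = suc k′} k≤ with m≤n⇒m<n∨m≡n k≤
... | inj₁ k<sk′ = ≤-trans (sumBelow-mono f (s≤s⁻¹ k<sk′)) (m≤m+n _ _)
... | inj₂ refl = ≤-refl

σ-sumBelow : ∀ w h k → σ w h (h + 2 * k) ≡ sumBelow (λ k → runLen w (h + 2 * k)) (suc k)
σ-sumBelow w h k = trans (cong (sumUpTo _) half) (sumUpTo≡sumBelow _ k)
  where
  half : (h + 2 * k ∸ h) / 2 ≡ k
  half = trans (cong (_/ 2) (trans (m+n∸m≡n h (2 * k)) (*-comm 2 k))) (m*n/n≡m k 2)

h+2[1+k]≡2+h+2k : ∀ h k → h + 2 * suc k ≡ suc (suc (h + 2 * k))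
h+2[1+k]≡2+h+2k h k = trans (cong (h +_) (*-suc 2 k)) (trans (+-suc h _) (cong suc (+-suc h _)))

α≡ : ∀ p w → 0 < length p → 0 < length w → α p w ≡ (if does (at p 0 ≟ᵇ at w 0) then 1 else 2)
α≡ (_ ∷ _) (_ ∷ _) _ _ = refl

module LexMin {p w : Word} (L : Occurrence p w) (minimal : IsLexMinOcc p w L) where

  -- Position in w of the j-th letter of p (0-based), with junk value 0 for j out of range.
  place : ℕ → ℕ
  place j with j <? length p
  ... | yes j<m = toℕ (pos L (fromℕ< j<m))
  ... | no _ = 0

  place-toℕ : ∀ f → place (toℕ f) ≡ toℕ (pos L f)
  place-toℕ f with toℕ f <? length p
  ... | yes f<m = cong (toℕ ∘ pos L) (fromℕ<-toℕ f f<m)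
  ... | no f≮m = contradiction (toℕ<n f) f≮m

  place-fromℕ< : ∀ {j} (j<m : j < length p) → place j ≡ toℕ (pos L (fromℕ< j<m))
  place-fromℕ< j<m = trans (cong place (sym (toℕ-fromℕ< j<m))) (place-toℕ (fromℕ< j<m))

  place<length : ∀ {j} → j < length p → place j < length w
  place<length j<m rewrite place-fromℕ< j<m = toℕ<n _

  place-letter : ∀ {j} → j < length p → at w (place j) ≡ at p j
  place-letter j<m rewrite place-fromℕ< j<m = begin
    at w (toℕ (pos L jf))  ≡⟨ lookup≡at w (pos L jf) ⟨
    lookup w (pos L jf)    ≡⟨ matches L jf ⟩
    lookup p jf            ≡⟨ lookup≡at p jf ⟩
    at p (toℕ jf)          ≡⟨ cong (at p) (toℕ-fromℕ< j<m) ⟩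
    at p _                 ∎
    where
    open ≡-Reasoning
    jf : Fin (length p)
    jf = fromℕ< j<m

  place-mono : ∀ {j j′} → j < j′ → j′ < length p → place j < place j′
  place-mono {j} {j′} j<j′ j′<m rewrite place-fromℕ< (<-trans j<j′ j′<m) | place-fromℕ< j′<m =
    increasing L _ _ (subst₂ _<_ (sym (toℕ-fromℕ< _)) (sym (toℕ-fromℕ< j′<m)) j<j′)

  place-mono≤ : ∀ {j j′} → j ≤ j′ → j′ < length p → place j ≤ place j′
  place-mono≤ j≤j′ j′<m with m≤n⇒m<n∨m≡n j≤j′
  ... | inj₁ j<j′ = <⇒≤ (place-mono j<j′ j′<m)
  ... | inj₂ refl = ≤-refl

  Above : ℕ → ℕ → Set
  Above zero q = ⊤
  Above (suc j) q = place j < q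

  place-exact : ∀ {j q} → j < length p → Above j q → q ≤ place j → at w q ≡ at p j → place j ≡ q
  place-exact {j} {q} j<m above q≤ q-letter = ≤-antisym place≤q q≤
    where
    jf : Fin (length p)
    jf = fromℕ< j<m
    qf : Fin (length w)
    qf = fromℕ< (≤-<-trans q≤ (place<length j<m))
    q-matches : lookup w qf ≡ lookup p jf
    q-matches = begin
      lookup w qf     ≡⟨ lookup≡at w qf ⟩
      at w (toℕ qf)   ≡⟨ cong (at w) (toℕ-fromℕ< _) ⟩
      at w q          ≡⟨ q-letter ⟩
      at p j          ≡⟨ cong (at p) (toℕ-fromℕ< j<m) ⟨
      at p (toℕ jf)   ≡⟨ lookup≡at p jf ⟨
      lookup p jf     ∎
      where open ≡-Reasoning
    below : ∀ j′ → j′ < length p → Above j′ q → ∀ f → toℕ f < j′ → toℕ (pos L f) < q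
    below (suc j′) sj′<m pj′<q f f<sj′ =
      ≤-<-trans (subst (_≤ place j′) (place-toℕ f) (place-mono≤ (s≤s⁻¹ f<sj′) (<-trans (n<1+n j′) sj′<m)))
                pj′<q
    place≤q : place j ≤ q
    place≤q = subst₂ _≤_ (sym (place-fromℕ< j<m)) (toℕ-fromℕ< _)
      (lexMin-least L minimal jf qf q-matches
        (λ f f<j → subst (toℕ (pos L f) <_) (sym (toℕ-fromℕ< _))
                     (below j j<m above f (subst (toℕ f <_) (toℕ-fromℕ< j<m) f<j))))

  HeadAt : ℕ → ℕ → Set
  HeadAt i h = 1 ≤ h × h ≤ numRuns w × place (runStart p i) ≡ runStart w h

  module Block {i h : ℕ} (i≥1 : 1 ≤ i) (i<r : suc i ≤ numRuns p) (headAt : HeadAt i h) where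

    h≥1 : 1 ≤ h
    h≥1 = proj₁ headAt

    h≤s : h ≤ numRuns w
    h≤s = proj₁ (proj₂ headAt)

    j₀ : ℕ
    j₀ = runStart p i

    c : Bool
    c = at p j₀

    len : ℕ → ℕ
    len k = runLen w (h + 2 * k)

    h+2k≥1 : ∀ k → 1 ≤ h + 2 * k
    h+2k≥1 k = ≤-trans h≥1 (m≤m+n h _)

    inBlock<end : ∀ {t} → t < runLen p i → t + j₀ < j₀ + runLen p i
    inBlock<end {t} t<a = subst (_< j₀ + runLen p i) (+-comm j₀ t) (+-monoʳ-< j₀ t<a)

    inBlock<length : ∀ {t} → t < runLen p i → t + j₀ < length p
    inBlock<length t<a = <-≤-trans (inBlock<end t<a) (runEnd≤length p i≥1 (<⇒≤ i<r))

    inBlock-letter : ∀ {t} → t < runLen p i → at p (t + j₀) ≡ c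
    inBlock-letter {t} t<a = at-inRun p i≥1 (<⇒≤ i<r) (m≤n+m j₀ t) (inBlock<end t<a)

    afterBlock : ∀ {t} → suc t ≡ runLen p i → suc t + j₀ ≡ runStart p (suc i)
    afterBlock st≡a = trans (cong (_+ j₀) st≡a) (trans (+-comm _ j₀) (sym (proj₁ (nextRun p i≥1 i<r))))

    afterBlock<length : ∀ {t} → suc t ≡ runLen p i → suc t + j₀ < length p
    afterBlock<length st≡a = subst (_< length p) (sym (afterBlock st≡a)) (runStart<length p (s≤s z≤n) i<r)

    afterBlock-letter : ∀ {t} → suc t ≡ runLen p i → at p (suc t + j₀) ≡ not c
    afterBlock-letter st≡a = trans (cong (at p) (afterBlock st≡a)) (proj₂ (nextRun p i≥1 i<r))

    -- The t-th letter of A_i (0-based) sits at offset o of B_{h+2k}, the runs B_h, ..., B_{h+2k-2}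
    -- being used up entirely before it.
    record Slot (t : ℕ) : Set where
      constructor slot
      field
        k o    : ℕ
        run≤   : h + 2 * k ≤ numRuns w
        o<len  : o < len k
        place≡ : place (t + j₀) ≡ runStart w (h + 2 * k) + o
        count  : sumBelow len k + o ≡ t

    slotAt : ∀ {t} k o H → H ≡ h + 2 * k → H ≤ numRuns w → o < runLen w H →
      place (t + j₀) ≡ runStart w H + o → sumBelow len k + o ≡ t → Slot t
    slotAt k o _ refl = slot k o

    slot-letter : ∀ {t} → t < runLen p i → (s : Slot t) → at w (runStart w (h + 2 * Slot.k s)) ≡ c
    slot-letter t<a (slot k o run≤ o<len place≡ _) = begin
      at w (runStart w (h + 2 * k))      ≡⟨ at-inRun w (h+2k≥1 k) run≤ (m≤m+n _ o) (+-monoʳ-< _ o<len) ⟨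
      at w (runStart w (h + 2 * k) + o)  ≡⟨ cong (at w) place≡ ⟨
      at w (place (_ + j₀))              ≡⟨ place-letter (inBlock<length t<a) ⟩
      at p (_ + j₀)                      ≡⟨ inBlock-letter t<a ⟩
      c                                  ∎
      where open ≡-Reasoning

    slot₀ : Slot 0
    slot₀ = slotAt 0 0 h (sym (+-identityʳ h)) h≤s (runLen-positive w h≥1 h≤s)
      (trans (proj₂ (proj₂ headAt)) (sym (+-identityʳ _))) refl

    current<next : ∀ {t} → suc t + j₀ < length p → (s : Slot t) →
      runStart w (h + 2 * Slot.k s) + Slot.o s < place (suc t + j₀)
    current<next next<m s = subst (_< place (suc _ + j₀)) (Slot.place≡ s) (place-mono (n<1+n _) next<m)

    slot-stay : ∀ {t} → suc t < runLen p i → (s : Slot t) → suc (Slot.o s) < len (Slot.k s) →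
      Slot (suc t)
    slot-stay {t} st<a s@(slot k o run≤ o<len place≡ count) so<len =
      slot k (suc o) run≤ so<len (trans place≡′ (sym (+-suc _ o))) (trans (+-suc _ o) (cong suc count))
      where
      start : ℕ
      start = runStart w (h + 2 * k)
      letter : at w (suc (start + o)) ≡ at p (suc t + j₀)
      letter = begin
        at w (suc (start + o))   ≡⟨ at-inRun w (h+2k≥1 k) run≤ (m≤n⇒m≤1+n (m≤m+n _ o))
                                      (subst (_< start + len k) (+-suc start o) (+-monoʳ-< start so<len)) ⟩
        at w start               ≡⟨ slot-letter (<-trans (n<1+n t) st<a) s ⟩
        c                        ≡⟨ inBlock-letter st<a ⟨
        at p (suc t + j₀)        ∎
        where open ≡-Reasoning
      place≡′ : place (suc t + j₀) ≡ suc (start + o)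
      place≡′ = place-exact (inBlock<length st<a) (s≤s (≤-reflexive place≡))
        (current<next (inBlock<length st<a) s) letter

    slot-jump : ∀ {t} → suc t < runLen p i → (s : Slot t) → len (Slot.k s) ≡ suc (Slot.o s) →
      Slot (suc t)
    slot-jump {t} st<a s@(slot k o run≤ o<len place≡ count) len≡
      with skipRun w (h+2k≥1 k) run≤ end≤next (place<length (inBlock<length st<a)) next-letter
      where
      end≤next : runStart w (h + 2 * k) + len k ≤ place (suc t + j₀)
      end≤next = subst (_≤ place (suc t + j₀))
        (sym (trans (cong (runStart w (h + 2 * k) +_) len≡) (+-suc _ o)))
        (current<next (inBlock<length st<a) s)
      next-letter : at w (place (suc t + j₀)) ≡ at w (runStart w (h + 2 * k))
      next-letter = trans (place-letter (inBlock<length st<a))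
        (trans (inBlock-letter st<a) (sym (slot-letter (<-trans (n<1+n t) st<a) s)))
    ... | next₂ , end≤start₂ , start₂≤next , letter₂ =
      slotAt (suc k) 0 (suc (suc (h + 2 * k))) (sym (h+2[1+k]≡2+h+2k h k)) next₂
        (runLen-positive w (s≤s z≤n) next₂) (trans place≡′ (sym (+-identityʳ _))) count′
      where
      place≡′ : place (suc t + j₀) ≡ runStart w (suc (suc (h + 2 * k)))
      place≡′ = place-exact (inBlock<length st<a)
        (subst (_< runStart w (suc (suc (h + 2 * k)))) (sym place≡) (<-≤-trans (+-monoʳ-< _ o<len) end≤start₂))
        start₂≤next
        (trans letter₂ (trans (slot-letter (<-trans (n<1+n t) st<a) s) (sym (inBlock-letter st<a))))
      count′ : sumBelow len (suc k) + 0 ≡ suc t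
      count′ = begin
        sumBelow len k + len k + 0   ≡⟨ +-identityʳ _ ⟩
        sumBelow len k + len k       ≡⟨ cong (sumBelow len k +_) len≡ ⟩
        sumBelow len k + suc o       ≡⟨ +-suc _ o ⟩
        suc (sumBelow len k + o)     ≡⟨ cong suc count ⟩
        suc t                        ∎
        where open ≡-Reasoning

    slot-suc : ∀ {t} → suc t < runLen p i → Slot t → Slot (suc t)
    slot-suc st<a s with suc (Slot.o s) <? len (Slot.k s)
    ... | yes so<len = slot-stay st<a s so<len
    ... | no so≮len = slot-jump st<a s (≤-antisym (≮⇒≥ so≮len) (Slot.o<len s))

    slots : ∀ t → t < runLen p i → Slot t
    slots zero _ = slot₀
    slots (suc t) st<a = slot-suc st<a (slots t (<-trans (n<1+n t) st<a))

    slot-rho : ∀ {t} → suc t ≡ runLen p i → (s : Slot t) → IsRho w h (runLen p i) (Slot.k s)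
    slot-rho {t} st≡a (slot k o run≤ o<len place≡ count) = run≤ , a≤σ , σ<a
      where
      a≤σ : runLen p i ≤ σ w h (h + 2 * k)
      a≤σ = begin
        runLen p i                ≡⟨ st≡a ⟨
        suc t                     ≡⟨ cong suc count ⟨
        suc (sumBelow len k + o)  ≡⟨ +-suc _ o ⟨
        sumBelow len k + suc o    ≤⟨ +-monoʳ-≤ (sumBelow len k) o<len ⟩
        sumBelow len (suc k)      ≡⟨ σ-sumBelow w h k ⟨
        σ w h (h + 2 * k)         ∎
        where open ≤-Reasoning
      σ<a : ∀ k′ → k′ < k → σ w h (h + 2 * k′) < runLen p i
      σ<a k′ k′<k = begin-strict
        σ w h (h + 2 * k′)        ≡⟨ σ-sumBelow w h k′ ⟩
        sumBelow len (suc k′)     ≤⟨ sumBelow-mono len k′<k ⟩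
        sumBelow len k            ≤⟨ m≤m+n _ o ⟩
        sumBelow len k + o        ≡⟨ count ⟩
        t                         <⟨ n<1+n t ⟩
        suc t                     ≡⟨ st≡a ⟩
        runLen p i                ∎
        where open ≤-Reasoning

    nextHead : ∀ {t} → suc t ≡ runLen p i → (s : Slot t) → HeadAt (suc i) (suc (h + 2 * Slot.k s))
    nextHead {t} st≡a s@(slot k o run≤ o<len place≡ count) =
      s≤s z≤n , next , trans (cong place (sym (afterBlock st≡a))) place≡′
      where
      start : ℕ
      start = runStart w (h + 2 * k)
      y : ℕ
      y = place (suc t + j₀)
      y≢ : at w y ≢ at w start
      y≢ y≡ = not-¬ refl (begin
        c                 ≡⟨ slot-letter (≤-reflexive st≡a) s ⟨
        at w start        ≡⟨ y≡ ⟨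
        at w y            ≡⟨ place-letter (afterBlock<length st≡a) ⟩
        at p (suc t + j₀) ≡⟨ afterBlock-letter st≡a ⟩
        not c             ∎)
        where open ≡-Reasoning
      leave : suc (h + 2 * k) ≤ numRuns w × runStart w (suc (h + 2 * k)) ≤ y
      leave = leaveRun w (h+2k≥1 k) run≤
        (≤-trans (m≤m+n start o) (<⇒≤ (current<next (afterBlock<length st≡a) s)))
        (place<length (afterBlock<length st≡a)) y≢
      next : suc (h + 2 * k) ≤ numRuns w
      next = proj₁ leave
      nextRun-w : runStart w (suc (h + 2 * k)) ≡ start + len k ×
                  at w (runStart w (suc (h + 2 * k))) ≡ not (at w start)
      nextRun-w = nextRun w (h+2k≥1 k) next
      place≡′ : y ≡ runStart w (suc (h + 2 * k))
      place≡′ = place-exact (afterBlock<length st≡a)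
        (subst₂ _<_ (sym place≡) (sym (proj₁ nextRun-w)) (+-monoʳ-< start o<len))
        (proj₂ leave)
        (trans (proj₂ nextRun-w)
          (trans (cong not (slot-letter (≤-reflexive st≡a) s)) (sym (afterBlock-letter st≡a))))

    blockEnd : ∃ λ k → IsRho w h (runLen p i) k × HeadAt (suc i) (h + 2 * k + 1)
    blockEnd = Slot.k s , slot-rho a′+1≡a s , subst (HeadAt (suc i)) (+-comm 1 _) (nextHead a′+1≡a s)
      where
      a′+1≡a : suc (pred (runLen p i)) ≡ runLen p i
      a′+1≡a = suc-pred _ {{>-nonZero (runLen-positive p i≥1 (<⇒≤ i<r))}}
      s : Slot (pred (runLen p i))
      s = slots _ (≤-reflexive a′+1≡a)

  firstHead : 1 ≤ numRuns p → HeadAt 1 (α p w)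
  firstHead r≥1 = subst (HeadAt 1) (sym (α≡ p w p>0 w>0)) (byFirstLetters (at p 0 ≟ᵇ at w 0))
    where
    p>0 : 0 < length p
    p>0 = length-positive p r≥1
    w>0 : 0 < length w
    w>0 = ≤-<-trans z≤n (place<length p>0)
    s≥1 : 1 ≤ numRuns w
    s≥1 = numRuns-positive w w>0
    w₀≡ : at w (runStart w 1) ≡ at w 0
    w₀≡ = cong (at w) (runStart₁ w)
    place₀≡ : ∀ {q} → q ≤ place 0 → at w q ≡ at p 0 → place (runStart p 1) ≡ q
    place₀≡ q≤ q-letter = trans (cong place (runStart₁ p)) (place-exact p>0 _ q≤ q-letter)
    byFirstLetters : (d : Dec (at p 0 ≡ at w 0)) → HeadAt 1 (if does d then 1 else 2)
    byFirstLetters (yes p₀≡w₀) =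
      s≤s z≤n , s≥1 , place₀≡ (runStart₁≤ w _) (trans w₀≡ (sym p₀≡w₀))
    byFirstLetters (no p₀≢w₀) = s≤s z≤n , proj₁ leave , place₀≡ (proj₂ leave) letter₂
      where
      leave : 2 ≤ numRuns w × runStart w 2 ≤ place 0
      leave = leaveRun w ≤-refl s≥1 (runStart₁≤ w _) (place<length p>0)
        (λ e → p₀≢w₀ (trans (sym (place-letter p>0)) (trans e w₀≡)))
      letter₂ : at w (runStart w 2) ≡ at p 0
      letter₂ = trans (proj₂ (nextRun w ≤-refl (proj₁ leave)))
        (trans (cong not w₀≡) (sym (¬-not p₀≢w₀)))

  heads : ∀ i → 1 ≤ i → i ≤ numRuns p → ∃ (HeadAt i)
  heads 1 _ r≥1 = α p w , firstHead r≥1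
  heads (suc (suc i)) _ i<r with heads (suc i) (s≤s z≤n) (<⇒≤ i<r)
  ... | _ , headAt with Block.blockEnd (s≤s z≤n) i<r headAt
  ...   | _ , _ , headAt′ = _ , headAt′

  head≡runIndex-place : ∀ i → runStart p i < length p → head p w L i ≡ runIndex w (place (runStart p i))
  head≡runIndex-place i i<m with runStart p i <? length p
  ... | yes _ = refl
  ... | no i≮m = contradiction i<m i≮m

  head≡ : ∀ {i h} → 1 ≤ i → i ≤ numRuns p → HeadAt i h → head p w L i ≡ h
  head≡ {i} {h} i≥1 i≤r (h≥1 , h≤s , start≡) = begin
    head p w L i                        ≡⟨ head≡runIndex-place i (runStart<length p i≥1 i≤r) ⟩
    runIndex w (place (runStart p i))   ≡⟨ cong (runIndex w) start≡ ⟩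
    runIndex w (runStart w h)           ≡⟨ runIndex-runStart w h≥1 h≤s ⟩
    h                                   ∎
    where open ≡-Reasoning

lemma1 : (p w : Word) (L : Occurrence p w) → IsLexMinOcc p w L →
    (1 ≤ numRuns p → head p w L 1 ≡ α p w) ×
    (∀ i → 1 ≤ i → i < numRuns p →
      ∃ λ k → IsRho w (head p w L i) (runLen p i) k ×
        head p w L (suc i) ≡ head p w L i + 2 * k + 1)
lemma1 p w L minimal = (λ r≥1 → head≡ ≤-refl r≥1 (firstHead r≥1)) , nextHeads
  where
  open LexMin L minimal
  nextHeads : ∀ i → 1 ≤ i → i < numRuns p →
    ∃ λ k → IsRho w (head p w L i) (runLen p i) k × head p w L (suc i) ≡ head p w L i + 2 * k + 1
  nextHeads i i≥1 i<r with heads i i≥1 (<⇒≤ i<r)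
  ... | h , headAt with Block.blockEnd i≥1 i<r headAt
  ...   | k , ρ , headAt′ rewrite head≡ i≥1 (<⇒≤ i<r) headAt =
    k , ρ , head≡ (s≤s z≤n) i<r headAt′
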